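{- For every $n\ge1$, the labeling $\lambda_\bullet$ of the pointed partition poset $\Pi_n^\bullet$ is injective on maximal chains in any interval: for all $\pi\le\pi'$ in $\Pi_n^\bullet$, distinct maximal chains of $[\pi,\pi']$ have distinct sequences of labels.
   Context: A pointed set is a pair $(A,p)$, written $A^p$, with $A$ a nonempty finite set and $p\in A$. A pointed partition of $[n]$ is a collection $B_1^{p_1}/\cdots/B_m^{p_m}$ of pointed sets such that $B_1/\cdots/B_m$ is a set partition of $[n]$. The poset $\Pi_n^\bullet$ consists of pointed partitions of $[n]$ with $\pi\lessdot\pi'$ exactly when $\pi'$ is obtained from $\pi$ by replacing two blocks $A^p,B^q$ (with $\min A<\min B$) by $(A\cup B)^p$ (a $1$-merge) or by $(A\cup B)^q$ (a $0$-merge), all other blocks unchanged. The labeling $\lambda_\bullet$ assigns to such a cover, obtained by a $u$-merge ($u\in\{0,1\}$), the label $(\min A,\min B)^u$. -}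

module Defs where

open import Data.Nat using (ℕ; _≤_; _<_)
open import Data.Fin using (Fin; toℕ)
open import Data.Vec using (Vec; lookup)
open import Data.Bool using (Bool; true; false)
open import Data.List using (List; []; _∷_)
open import Data.Product using (Σ; ∃; _×_; _,_)
open import Relation.Binary.PropositionalEquality using (_≡_; _≢_)
open import Relation.Binary.Construct.Closure.ReflexiveTransitive using (Star)

-- Encoding of a pointed partition of [n] (elements of [n] are Fin n):
-- a vector v sending each element i to the point of the block containing i.
-- Such v are exactly the idempotent maps; blocks = fibres of v, points = fixed points.
Raw : ℕ → Set
Raw n = Vec (Fin n) n

IsPointedPartition : ∀ {n} → Raw n → Set
IsPointedPartition v = ∀ i → lookup v (lookup v i) ≡ lookup v i

IsMinOfBlock : ∀ {n} → Raw n → Fin n → Fin n → Set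
IsMinOfBlock v p m = lookup v m ≡ p × (∀ j → lookup v j ≡ p → toℕ m ≤ toℕ j)

-- Labels (a , b)^u, with u ∈ {0,1} encoded as Bool (true = 1, false = 0).
record Label (n : ℕ) : Set where
  constructor ⟨_,_⟩^_
  field
    fst : Fin n
    snd : Fin n
    u   : Bool

-- w is obtained from v by merging block A (point p) and block B (point q),
-- min A = a < b = min B, keeping point p (u = 1, a 1-merge) or q (u = 0, a 0-merge);
-- all other blocks unchanged.
MergeResult : ∀ {n} → Raw n → Raw n → Fin n → Fin n → Bool → Set
MergeResult v w p q true  =
  ∀ i → (lookup v i ≡ q → lookup w i ≡ p) × (lookup v i ≢ q → lookup w i ≡ lookup v i)
MergeResult v w p q false =
  ∀ i → (lookup v i ≡ p → lookup w i ≡ q) × (lookup v i ≢ p → lookup w i ≡ lookup v i)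

record CoverWithLabel {n : ℕ} (v w : Raw n) (ℓ : Label n) : Set where
  open Label ℓ
  field
    ppv   : IsPointedPartition v
    ppw   : IsPointedPartition w
    p q   : Fin n
    pfix  : lookup v p ≡ p
    qfix  : lookup v q ≡ q
    p≢q   : p ≢ q
    minA  : IsMinOfBlock v p fst
    minB  : IsMinOfBlock v q snd
    a<b   : toℕ fst < toℕ snd
    merge : MergeResult v w p q u

_⋖_ : ∀ {n} → Raw n → Raw n → Set
v ⋖ w = ∃ λ ℓ → CoverWithLabel v w ℓ

_≤•_ : ∀ {n} → Raw n → Raw n → Set
v ≤• w = IsPointedPartition v × Star _⋖_ v w

data MaxChain {n : ℕ} : Raw n → Raw n → List (Raw n) → List (Label n) → Set where
  done : ∀ {x} → IsPointedPartition x → MaxChain x x (x ∷ []) []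
  step : ∀ {x z y cs ls ℓ} → CoverWithLabel x z ℓ → MaxChain z y cs ls →
         MaxChain x y (x ∷ cs) (ℓ ∷ ls)

{-# OPTIONS --safe #-}
module Submission where

-- Since a block is determined by any of its elements, the label
-- pins down the two blocks and the surviving point, hence the upper element of the
-- cover.  So covers with a given label are deterministic, and a maximal chain is
-- recovered from its bottom element and its label sequence.

open import Defs
open import Data.Nat using (ℕ; _≥_)
open import Data.List using (List; _∷_)
open import Data.Fin using (Fin; _≟_)
open import Data.Vec using (lookup; tabulate)
open import Data.Vec.Properties using (tabulate∘lookup; tabulate-cong)
open import Data.Bool using (Bool; true; false)
open import Data.Product using (_×_; proj₁; proj₂)
open import Relation.Nullary using (yes; no)
open import Relation.Binary.PropositionalEquality

private
  variable
    n : ℕ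

lookup-extensional : {w w′ : Raw n} → (∀ i → lookup w i ≡ lookup w′ i) → w ≡ w′
lookup-extensional {w = w} {w′} eq = begin
  w                    ≡⟨ tabulate∘lookup w ⟨
  tabulate (lookup w)  ≡⟨ tabulate-cong eq ⟩
  tabulate (lookup w′) ≡⟨ tabulate∘lookup w′ ⟩
  w′                   ∎
  where open ≡-Reasoning

Redirect : Raw n → Raw n → Fin n → Fin n → Set
Redirect v w from to =
  ∀ i → (lookup v i ≡ from → lookup w i ≡ to) × (lookup v i ≢ from → lookup w i ≡ lookup v i)

redirect-unique : ∀ {v w w′ : Raw n} {from to} →
  Redirect v w from to → Redirect v w′ from to → w ≡ w′
redirect-unique {v = v} {w} {w′} {from} r r′ = lookup-extensional pointwise
  where
  pointwise : ∀ i → lookup w i ≡ lookup w′ i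
  pointwise i with lookup v i ≟ from
  ... | yes e = trans (proj₁ (r i) e) (sym (proj₁ (r′ i) e))
  ... | no ne = trans (proj₂ (r i) ne) (sym (proj₂ (r′ i) ne))

mergeResult-unique : ∀ {v w w′ : Raw n} {p q} (u : Bool) →
  MergeResult v w p q u → MergeResult v w′ p q u → w ≡ w′
mergeResult-unique {v = v} true  = redirect-unique {v = v}
mergeResult-unique {v = v} false = redirect-unique {v = v}

cover-deterministic : ∀ {v w w′ : Raw n} {ℓ} →
  CoverWithLabel v w ℓ → CoverWithLabel v w′ ℓ → w ≡ w′
cover-deterministic {v = v} {w′ = w′} {ℓ} c d =
  mergeResult-unique (Label.u ℓ) C.merge
    (subst₂ (λ p q → MergeResult v w′ p q (Label.u ℓ)) (sym same-p) (sym same-q) D.merge)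
  where
  module C = CoverWithLabel c
  module D = CoverWithLabel d
  same-p : C.p ≡ D.p
  same-p = trans (sym (proj₁ C.minA)) (proj₁ D.minA)
  same-q : C.q ≡ D.q
  same-q = trans (sym (proj₁ C.minB)) (proj₁ D.minB)

maxChain-determined-by-labels : ∀ {x y : Raw n} {cs cs′ ls} →
  MaxChain x y cs ls → MaxChain x y cs′ ls → cs ≡ cs′
maxChain-determined-by-labels (done _) (done _) = refl
maxChain-determined-by-labels (step c m) (step d m′) with cover-deterministic c d
... | refl = cong (_ ∷_) (maxChain-determined-by-labels m m′)

proposition2p9 : (n : ℕ) → n ≥ 1 → (π π′ : Raw n) → π ≤• π′ →
    (c₁ c₂ : List (Raw n)) (ls : List (Label n)) →
    MaxChain π π′ c₁ ls → MaxChain π π′ c₂ ls → c₁ ≡ c₂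
proposition2p9 _ _ _ _ _ _ _ _ = maxChain-determined-by-labels
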